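{- Let $T$ be a string, $\phi(i,j,w)$ an edit operation, $L=T[1..i-1]$, $R=T[j+1..|T|]$ and $T'=LwR$, with $|L|\ge|R|$, $|w|\le |L|/2$, and such that the longest border of $Lw$ is longer than $|w|$. Suppose $T'$ has a border longer than $R$, and let $b^\star$ be the border of $Lw$ such that $b^\star R$ is the longest border of $T'$. Partition the set of borders of $Lw$ into groups $G_1,\dots,G_m$ such that all borders in a group have the same smallest period and $p_k$ (the period of borders in $G_k$) satisfies $p_k>p_{k+1}$; let $k^\star$ be the index with $b^\star\in G_{k^\star}$. For each $k$, let $\alpha_k$ be the exponent of the longest prefix of $T'$ with period $p_k$, and let $r_k = \mathit{lce}_{T'}(|T'|-|R|-p_k+1,\ |T'|-|R|+1)$. If $b^\star$ is periodic, then $b^\star$ is the longest border of $Lw$ whose length is at most $\alpha_{k^\star}p_{k^\star} - r_{k^\star}$.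
   Context: A border of a non-empty string $S$ is a string that is both a proper prefix and a proper suffix of $S$. If $S$ has a border $b$, $|S|-|b|$ is a period of $S$; $\mathsf{per}(S)$ is the smallest period. The exponent of $S$ is $|S|/\mathsf{per}(S)$. $S$ is periodic if $\mathsf{per}(S)\le |S|/2$. For a string $S$ and positions $a,b$, $\mathit{lce}_S(a,b)$ is the length of the longest common prefix of $S[a..|S|]$ and $S[b..|S|]$. The edit $\phi(i,j,w)$ with $1\le j\le |T|$, $1\le i\le j+1$ produces $T'=T[1..i-1]\,w\,T[j+1..|T|]$. -}

module Defs where

open import Data.Nat using (ℕ; _+_; _*_; _≤_; _<_)
open import Data.List using (List; _++_; length; take; drop)
open import Data.Product using (Σ; ∃; _×_)
open import Relation.Binary.PropositionalEquality using (_≡_)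

-- Strings over an arbitrary alphabet A are lists; positions below are 0-based
-- unless stated otherwise.

module _ {A : Set} where

  IsPrefix : List A → List A → Set
  IsPrefix u S = ∃ λ v → u ++ v ≡ S

  IsSuffix : List A → List A → Set
  IsSuffix u S = ∃ λ v → v ++ u ≡ S

  IsBorder : List A → List A → Set
  IsBorder S b = length b < length S × IsPrefix b S × IsSuffix b S

  IsLongestBorder : List A → List A → Set
  IsLongestBorder S b = IsBorder S b × (∀ c → IsBorder S c → length c ≤ length b)

  IsPeriod : List A → ℕ → Set
  IsPeriod S p = ∃ λ b → IsBorder S b × p + length b ≡ length S

  IsPer : List A → ℕ → Set
  IsPer S p = IsPeriod S p × (∀ q → IsPeriod S q → p ≤ q)

  IsLongestPrefixWithPeriod : List A → ℕ → List A → Set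
  IsLongestPrefixWithPeriod S p X =
    IsPrefix X S × IsPeriod X p ×
    (∀ Y → IsPrefix Y S → IsPeriod Y p → length Y ≤ length X)

  IsLCP : List A → List A → ℕ → Set
  IsLCP u v n =
    n ≤ length u × n ≤ length v × take n u ≡ take n v ×
    (∀ m → m ≤ length u → m ≤ length v → take m u ≡ take m v → m ≤ n)

  -- n = lce_S(a+1, b+1) in the paper's 1-based notation, i.e. the lcp of
  -- the suffixes of S starting at 0-based positions a and b.
  IsLCE : List A → ℕ → ℕ → ℕ → Set
  IsLCE S a b n = IsLCP (drop a S) (drop b S) n

-- Write T′ = U R with U = Lw, and let c = |U| − |b⋆|. Since b⋆ R is a border of T′, the string T′
-- has period c, which copies the comparison defining r (at |U| − p and |U|) to the positions
-- |b⋆| − p and |b⋆|. So the prefix of length |b⋆| + r has period p, whence |b⋆| + r ≤ |X|; and as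
-- b⋆ is then a prefix of X, per(X) = p. Now let b be a border of U with |b| + r ≤ |X|. If r < |R|,
-- the mismatch ending the lce is copied as well, so |X| ≤ |b⋆| + r. If r = |R|, the factors of T′
-- starting at |b| − p and at |U| − p both have period p over length p + |R| and both start with
-- the last p letters of b; hence they coincide, b R is a border of T′, and |b| ≤ |b⋆| by maximality.

{-# OPTIONS --safe #-}
module Submission where

open import Defs
open import Data.Nat
  using (ℕ; zero; suc; _+_; _*_; _∸_; _≤_; _<_; s≤s; z<s; _≤?_; _<?_; NonZero; >-nonZero)
open import Data.Nat.Properties
open import Data.List using (List; []; _∷_; _++_; length; take; drop)
open import Data.List.Properties
  using (length-++; length-take; length-drop; take++drop≡id; take-all; ++-assoc)
open import Data.Maybe using (Maybe; just; nothing)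
open import Data.Product using (∃; _×_; _,_; proj₁; proj₂)
open import Relation.Nullary using (yes; no; ¬_; contradiction)
open import Data.Sum using (inj₁; inj₂)
open import Relation.Binary.PropositionalEquality

module _ {A : Set} where

  -- Out-of-range positions give nothing, so pointwise equal lookups force equal lengths.
  _!_ : List A → ℕ → Maybe A
  []      ! _     = nothing
  (a ∷ u) ! zero  = just a
  (a ∷ u) ! suc k = u ! k

  !-++ˡ : ∀ (u v : List A) {k} → k < length u → (u ++ v) ! k ≡ u ! k
  !-++ˡ (a ∷ u) v {zero}  _         = refl
  !-++ˡ (a ∷ u) v {suc k} (s≤s k<u) = !-++ˡ u v k<u

  !-++ʳ : ∀ (u v : List A) k → (u ++ v) ! (length u + k) ≡ v ! k
  !-++ʳ []      v k = refl
  !-++ʳ (a ∷ u) v k = !-++ʳ u v k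

  !-take : ∀ m (u : List A) {k} → k < m → take m u ! k ≡ u ! k
  !-take (suc m) []      _         = refl
  !-take (suc m) (a ∷ u) {zero}  _         = refl
  !-take (suc m) (a ∷ u) {suc k} (s≤s k<m) = !-take m u k<m

  !-drop : ∀ m (u : List A) k → drop m u ! k ≡ u ! (m + k)
  !-drop zero    u       k = refl
  !-drop (suc m) []      k = refl
  !-drop (suc m) (a ∷ u) k = !-drop m u k

  !-take-≡ : ∀ m (u v : List A) → (∀ {k} → k < m → u ! k ≡ v ! k) → take m u ≡ take m v
  !-take-≡ zero    u       v       _ = refl
  !-take-≡ (suc m) []      []      _ = refl
  !-take-≡ (suc m) []      (b ∷ v) u≗v with u≗v z<s
  ... | ()
  !-take-≡ (suc m) (a ∷ u) []      u≗v with u≗v z<s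
  ... | ()
  !-take-≡ (suc m) (a ∷ u) (b ∷ v) u≗v with u≗v z<s
  ... | refl = cong (a ∷_) (!-take-≡ m u v (λ k<m → u≗v (s≤s k<m)))

  prefix-! : ∀ {u S : List A} → IsPrefix u S → ∀ {k} → k < length u → S ! k ≡ u ! k
  prefix-! {u} (v , refl) = !-++ˡ u v

  suffix-! : ∀ {u v S : List A} → v ++ u ≡ S → ∀ k → S ! (length v + k) ≡ u ! k
  suffix-! {u} {v} refl = !-++ʳ v u

  !-prefix : ∀ (u S : List A) → (∀ {k} → k < length u → S ! k ≡ u ! k) → IsPrefix u S
  !-prefix u S S≗u = drop (length u) S , (begin
    u ++ drop (length u) S               ≡⟨ cong (_++ drop (length u) S) u≡take ⟩
    take (length u) S ++ drop (length u) S ≡⟨ take++drop≡id (length u) S ⟩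
    S                                    ∎)
    where
    open ≡-Reasoning
    u≡take : u ≡ take (length u) S
    u≡take = trans (sym (take-all (length u) u ≤-refl)) (sym (!-take-≡ (length u) S u S≗u))

  ++-prefix : ∀ {u S : List A} (v : List A) → IsPrefix u S →
    (∀ {j} → j < length v → S ! (length u + j) ≡ v ! j) → IsPrefix (u ++ v) S
  ++-prefix {u} {S} v u-prefix v-follows = !-prefix (u ++ v) S S≗uv
    where
    S≗uv : ∀ {k} → k < length (u ++ v) → S ! k ≡ (u ++ v) ! k
    S≗uv {k} k<uv with k <? length u
    ... | yes k<u = trans (prefix-! u-prefix k<u) (sym (!-++ˡ u v k<u))
    ... | no k≮u with m≤n⇒∃[o]m+o≡n (≮⇒≥ k≮u)
    ... | j , refl = trans (v-follows j<v) (sym (!-++ʳ u v j))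
      where
      j<v : j < length v
      j<v = +-cancelˡ-< (length u) j (length v) (subst (_ <_) (length-++ u) k<uv)

  prefix-of-prefix : ∀ {u v S : List A} → IsPrefix u S → IsPrefix v S →
    length u ≤ length v → IsPrefix u v
  prefix-of-prefix {u} {v} u-prefix v-prefix u≤v = !-prefix u v λ k<u →
    trans (sym (prefix-! v-prefix (<-≤-trans k<u u≤v))) (prefix-! u-prefix k<u)

  prefix-length : ∀ {u S : List A} → IsPrefix u S → length u ≤ length S
  prefix-length {u} (v , refl) =
    subst (length u ≤_) (sym (length-++ u)) (m≤m+n (length u) (length v))

  prefix-trans : ∀ {u v S : List A} → IsPrefix u v → IsPrefix v S → IsPrefix u S
  prefix-trans {u} (x , refl) (y , refl) = x ++ y , sym (++-assoc u x y)

  take-prefix : ∀ l (S : List A) → IsPrefix (take l S) S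
  take-prefix l S = drop l S , take++drop≡id l S

  suffix-++ : ∀ {u v U R t : List A} → v ++ u ≡ U → U ++ R ≡ t → v ++ (u ++ R) ≡ t
  suffix-++ {u} {v} {R = R} refl refl = sym (++-assoc v u R)

  record Agree (S : List A) (a b m : ℕ) : Set where
    constructor agree
    field match : ∀ {k} → k < m → S ! (a + k) ≡ S ! (b + k)

  open Agree public

  Agree-sym : ∀ {S a b m} → Agree S a b m → Agree S b a m
  Agree-sym ab = agree λ k<m → sym (match ab k<m)

  Agree-trans : ∀ {S a b c m} → Agree S a b m → Agree S b c m → Agree S a c m
  Agree-trans ab bc = agree λ k<m → trans (match ab k<m) (match bc k<m)

  Agree-≤ : ∀ {S a b m n} → m ≤ n → Agree S a b n → Agree S a b m
  Agree-≤ m≤n ab = agree λ k<m → match ab (<-≤-trans k<m m≤n)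

  Agree-drop : ∀ {S a b} k {m} → Agree S a b (k + m) → Agree S (a + k) (b + k) m
  Agree-drop {S} {a} {b} k ab = agree λ {j} j<m → begin
    S ! (a + k + j)   ≡⟨ cong (S !_) (+-assoc a k j) ⟩
    S ! (a + (k + j)) ≡⟨ match ab (+-monoʳ-< k j<m) ⟩
    S ! (b + (k + j)) ≡⟨ cong (S !_) (sym (+-assoc b k j)) ⟩
    S ! (b + k + j)   ∎
    where open ≡-Reasoning

  Agree-++ : ∀ {S a b k m} → Agree S a b k → Agree S (a + k) (b + k) m → Agree S a b (k + m)
  Agree-++ {S} {a} {b} {k} {m} first rest = agree combined
    where
    combined : ∀ {i} → i < k + m → S ! (a + i) ≡ S ! (b + i)
    combined {i} i<k+m with i <? k
    ... | yes i<k = match first i<k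
    ... | no i≮k with m≤n⇒∃[o]m+o≡n (≮⇒≥ i≮k)
    ... | j , refl = begin
      S ! (a + (k + j)) ≡⟨ cong (S !_) (sym (+-assoc a k j)) ⟩
      S ! (a + k + j)   ≡⟨ match rest (+-cancelˡ-< k j m i<k+m) ⟩
      S ! (b + k + j)   ≡⟨ cong (S !_) (+-assoc b k j) ⟩
      S ! (b + (k + j)) ∎
      where open ≡-Reasoning

  Agree-prefix⁺ : ∀ {u S : List A} {a b m} → IsPrefix u S → a + m ≤ length u → b + m ≤ length u →
    Agree u a b m → Agree S a b m
  Agree-prefix⁺ {a = a} {b} u-prefix a+m≤u b+m≤u ab = agree λ k<m →
    trans (prefix-! u-prefix (<-≤-trans (+-monoʳ-< a k<m) a+m≤u))
      (trans (match ab k<m) (sym (prefix-! u-prefix (<-≤-trans (+-monoʳ-< b k<m) b+m≤u))))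

  Agree-prefix⁻ : ∀ {u S : List A} {a b m} → IsPrefix u S → a + m ≤ length u → b + m ≤ length u →
    Agree S a b m → Agree u a b m
  Agree-prefix⁻ {a = a} {b} u-prefix a+m≤u b+m≤u ab = agree λ k<m →
    trans (sym (prefix-! u-prefix (<-≤-trans (+-monoʳ-< a k<m) a+m≤u)))
      (trans (match ab k<m) (prefix-! u-prefix (<-≤-trans (+-monoʳ-< b k<m) b+m≤u)))

  Agree⇒take-drop : ∀ {S : List A} {a b m} → Agree S a b m → take m (drop a S) ≡ take m (drop b S)
  Agree⇒take-drop {S} {a} {b} {m} ab = !-take-≡ m (drop a S) (drop b S) λ {k} k<m →
    trans (!-drop a S k) (trans (match ab k<m) (sym (!-drop b S k)))

  take-drop⇒Agree : ∀ {S : List A} {a b m} → take m (drop a S) ≡ take m (drop b S) → Agree S a b m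
  take-drop⇒Agree {S} {a} {b} {m} eq = agree λ {k} k<m → begin
    S ! (a + k)             ≡⟨ sym (!-drop a S k) ⟩
    drop a S ! k            ≡⟨ sym (!-take m (drop a S) k<m) ⟩
    take m (drop a S) ! k   ≡⟨ cong (_! k) eq ⟩
    take m (drop b S) ! k   ≡⟨ !-take m (drop b S) k<m ⟩
    drop b S ! k            ≡⟨ !-drop b S k ⟩
    S ! (b + k)             ∎
    where open ≡-Reasoning

  border-Agree : ∀ {b v S : List A} → IsPrefix b S → v ++ b ≡ S → Agree S 0 (length v) (length b)
  border-Agree {b} {v} b-prefix v++b≡S = agree λ {k} k<b →
    trans (prefix-! b-prefix k<b) (sym (suffix-! {u = b} {v} v++b≡S k))

  Agree-snoc : ∀ {S : List A} {a b m} → Agree S a b m → S ! (a + m) ≡ S ! (b + m) →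
    Agree S a b (suc m)
  Agree-snoc {S} {a} {b} {m} ab last = agree extended
    where
    extended : ∀ {k} → k < suc m → S ! (a + k) ≡ S ! (b + k)
    extended k<1+m with m<1+n⇒m<n∨m≡n k<1+m
    ... | inj₁ k<m = match ab k<m
    ... | inj₂ refl = last

  Agree-periodic : ∀ {S : List A} {a a′ p} m → 0 < p →
    Agree S a (a + p) m → Agree S a′ (a′ + p) m → Agree S a a′ p → Agree S a a′ (p + m)
  Agree-periodic {p = p} zero _ _ _ aa′ = Agree-≤ (≤-reflexive (+-identityʳ p)) aa′
  Agree-periodic {S} {a} {a′} {p} (suc m) 0<p a-periodic a′-periodic aa′ =
    Agree-≤ (≤-reflexive (+-suc p m)) (Agree-snoc agree-p+m next)
    where
    agree-p+m : Agree S a a′ (p + m)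
    agree-p+m = Agree-periodic m 0<p
      (Agree-≤ (n≤1+n m) a-periodic) (Agree-≤ (n≤1+n m) a′-periodic) aa′
    next : S ! (a + (p + m)) ≡ S ! (a′ + (p + m))
    next = begin
      S ! (a + (p + m))  ≡⟨ cong (S !_) (sym (+-assoc a p m)) ⟩
      S ! (a + p + m)    ≡⟨ sym (match a-periodic (n<1+n m)) ⟩
      S ! (a + m)        ≡⟨ match agree-p+m (m<n+m m 0<p) ⟩
      S ! (a′ + m)       ≡⟨ match a′-periodic (n<1+n m) ⟩
      S ! (a′ + p + m)   ≡⟨ cong (S !_) (+-assoc a′ p m) ⟩
      S ! (a′ + (p + m)) ∎
      where open ≡-Reasoning

  period-pos : ∀ {S : List A} {p} → IsPeriod S p → 0 < p
  period-pos {p = zero}  (b , (b<S , _) , b≡S) = contradiction b<S (<-irrefl b≡S)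
  period-pos {p = suc p} _                     = z<s

  period-≤ : ∀ {S : List A} {p} → IsPeriod S p → p ≤ length S
  period-≤ {p = p} (b , _ , p+b≡S) = subst (p ≤_) p+b≡S (m≤m+n p (length b))

  period⇒Agree : ∀ {S : List A} {p} → IsPeriod S p → ∃ λ m → p + m ≡ length S × Agree S 0 p m
  period⇒Agree {S} {p} (b , (_ , b-prefix , v , v++b≡S) , p+b≡S) =
    length b , p+b≡S , subst (λ o → Agree S 0 o (length b)) v≡p (border-Agree b-prefix v++b≡S)
    where
    v≡p : length v ≡ p
    v≡p = +-cancelʳ-≡ (length b) (length v) p
            (trans (trans (sym (length-++ v)) (cong length v++b≡S)) (sym p+b≡S))

  Agree⇒period : ∀ {S : List A} {p m} → 0 < p → p + m ≡ length S → Agree S 0 p m → IsPeriod S p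
  Agree⇒period {S} {p} {m} 0<p p+m≡S periodic =
    drop p S , (rest<S , !-prefix (drop p S) S S≗rest , take p S , take++drop≡id p S) , p+rest≡S
    where
    rest≡m : length (drop p S) ≡ m
    rest≡m = trans (length-drop p S) (trans (cong (_∸ p) (sym p+m≡S)) (m+n∸m≡n p m))
    rest<S : length (drop p S) < length S
    rest<S = subst₂ _<_ (sym rest≡m) p+m≡S (m<n+m m 0<p)
    S≗rest : ∀ {k} → k < length (drop p S) → S ! k ≡ drop p S ! k
    S≗rest {k} k<rest = trans (match periodic (subst (k <_) rest≡m k<rest)) (sym (!-drop p S k))
    p+rest≡S : p + length (drop p S) ≡ length S
    p+rest≡S = trans (cong (p +_) rest≡m) p+m≡S

  period-prefix : ∀ {u S : List A} {q} → IsPrefix u S → q ≤ length u → IsPeriod S q → IsPeriod u q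
  period-prefix {u} {S} {q} u-prefix q≤u q-period with period⇒Agree q-period
  ... | m , q+m≡S , periodic =
    Agree⇒period (period-pos q-period) q+m′≡u
      (Agree-prefix⁻ u-prefix (m∸n≤m (length u) q) (≤-reflexive q+m′≡u) (Agree-≤ m′≤m periodic))
    where
    q+m′≡u : q + (length u ∸ q) ≡ length u
    q+m′≡u = m+[n∸m]≡n q≤u
    m′≤m : length u ∸ q ≤ m
    m′≤m = +-cancelˡ-≤ q _ _
      (subst₂ _≤_ (sym q+m′≡u) (sym q+m≡S) (prefix-length u-prefix))

  per-unique : ∀ {u S : List A} {p q} → IsPrefix u S → IsPer u p → IsPeriod S p → IsPer S q → q ≡ p
  per-unique u-prefix (p-period , p-min) S-p (q-period , q-min) =
    ≤-antisym q≤p (p-min _ (period-prefix u-prefix (≤-trans q≤p (period-≤ p-period)) q-period))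
    where
    q≤p = q-min _ S-p

  longest-periodic-prefix-Agree : ∀ {S X : List A} {p} → IsLongestPrefixWithPeriod S p X →
    ∃ λ y → p + y ≡ length X × Agree S 0 p y
  longest-periodic-prefix-Agree (X-prefix , X-period , _) with period⇒Agree X-period
  ... | y , p+y≡X , periodic =
    y , p+y≡X , Agree-prefix⁺ X-prefix (subst (y ≤_) p+y≡X (m≤n+m y _)) (≤-reflexive p+y≡X) periodic

  longest-periodic-prefix-max : ∀ {S X : List A} {p z} → IsLongestPrefixWithPeriod S p X →
    p + z ≤ length S → Agree S 0 p z → p + z ≤ length X
  longest-periodic-prefix-max {S} {X} {p} {z} (_ , X-period , X-max) p+z≤S periodic =
    subst (_≤ length X) prefix≡p+z (X-max (take (p + z) S) (take-prefix (p + z) S) prefix-period)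
    where
    prefix≡p+z : length (take (p + z) S) ≡ p + z
    prefix≡p+z = trans (length-take (p + z) S) (m≤n⇒m⊓n≡m p+z≤S)
    prefix-period : IsPeriod (take (p + z) S) p
    prefix-period = Agree⇒period (period-pos X-period) (sym prefix≡p+z)
      (Agree-prefix⁻ (take-prefix (p + z) S) (subst (z ≤_) (sym prefix≡p+z) (m≤n+m z p))
        (≤-reflexive (sym prefix≡p+z)) periodic)

  lce-Agree : ∀ {S : List A} {a b r} → IsLCE S a b r → Agree S a b r
  lce-Agree (_ , _ , take-eq , _) = take-drop⇒Agree take-eq

  lce-mismatch : ∀ {S : List A} {a b r} → IsLCE S a b r → a ≤ b → r < length (drop b S) →
    ¬ S ! (a + r) ≡ S ! (b + r)
  lce-mismatch {S} {a} {b} {r} lce@(_ , _ , _ , lce-max) a≤b r<b next =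
    <-irrefl refl (lce-max (suc r) r<a r<b
      (Agree⇒take-drop (Agree-snoc {S} {a} {b} (lce-Agree lce) next)))
    where
    r<a : r < length (drop a S)
    r<a = <-≤-trans r<b (subst₂ _≤_ (sym (length-drop b S)) (sym (length-drop a S))
      (∸-monoʳ-≤ (length S) a≤b))

module BordersAfterEdit {A : Set} {U R t bs v : List A} (U++R≡t : U ++ R ≡ t)
  (bs-prefix : IsPrefix bs U) (v++bs≡U : v ++ bs ≡ U) (bsR-longest : IsLongestBorder t (bs ++ R))
  {p : ℕ} (p-per : IsPer bs p)
  {X : List A} (X-longest : IsLongestPrefixWithPeriod t p X)
  {r : ℕ} (r-lce : IsLCE t (length U ∸ p) (length U) r) where

  private
    n c s : ℕ
    n = length R
    c = length v
    s = proj₁ (period⇒Agree (proj₁ p-per))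

    p+s≡bs : p + s ≡ length bs
    p+s≡bs = proj₁ (proj₂ (period⇒Agree (proj₁ p-per)))

    U≡c+bs : length U ≡ c + (p + s)
    U≡c+bs = trans (cong length (sym v++bs≡U)) (trans (length-++ v) (cong (c +_) (sym p+s≡bs)))

    t≡U+n : length t ≡ length U + n
    t≡U+n = trans (cong length (sym U++R≡t)) (length-++ U)

    U-prefix : IsPrefix U t
    U-prefix = R , U++R≡t

    bs-prefix-t : IsPrefix bs t
    bs-prefix-t = prefix-trans bs-prefix U-prefix

    bs-periodic : Agree t 0 p s
    bs-periodic = Agree-prefix⁺ bs-prefix-t (subst (s ≤_) p+s≡bs (m≤n+m s p)) (≤-reflexive p+s≡bs)
      (proj₂ (proj₂ (period⇒Agree (proj₁ p-per))))

    -- bs R is both a prefix and a suffix of t, so t has period c.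
    t-periodic : Agree t 0 c (p + s + n)
    t-periodic = subst (Agree t 0 c) (trans (length-++ bs) (cong (_+ n) (sym p+s≡bs)))
      (border-Agree {v = v} (proj₁ (proj₂ (proj₁ bsR-longest)))
        (suffix-++ {u = bs} {v} v++bs≡U U++R≡t))

    left-copy : Agree t s (c + s) (p + n)
    left-copy = Agree-drop s
      (subst (Agree t 0 c) (trans (cong (_+ n) (+-comm p s)) (+-assoc s p n)) t-periodic)

    right-copy : Agree t (p + s) (c + (p + s)) n
    right-copy = Agree-drop (p + s) t-periodic

    c+[p+s]≡c+s+p : c + (p + s) ≡ c + s + p
    c+[p+s]≡c+s+p = trans (cong (c +_) (+-comm p s)) (sym (+-assoc c s p))

    lce-start : length U ∸ p ≡ c + s
    lce-start = trans (cong (_∸ p) (trans U≡c+bs c+[p+s]≡c+s+p)) (m+n∸n≡m (c + s) p)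

    lce-agree : Agree t (c + s) (c + (p + s)) r
    lce-agree = subst₂ (λ a b → Agree t a b r) lce-start U≡c+bs (lce-Agree r-lce)

    R≡drop : length (drop (length U) t) ≡ n
    R≡drop = trans (length-drop (length U) t)
      (trans (cong (_∸ length U) t≡U+n) (m+n∸m≡n (length U) n))

    r≤n : r ≤ n
    r≤n = subst (r ≤_) R≡drop (proj₁ (proj₂ r-lce))

    mismatch : r < n → ¬ t ! (c + s + r) ≡ t ! (c + (p + s) + r)
    mismatch r<n same = lce-mismatch r-lce (m∸n≤m (length U) p) (subst (r <_) (sym R≡drop) r<n)
      (subst₂ (λ a b → t ! (a + r) ≡ t ! (b + r)) (sym lce-start) (sym U≡c+bs) same)

    p-nonZero : NonZero p
    p-nonZero = >-nonZero (period-pos (proj₁ p-per))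

    shifted-mismatch : r < n → ¬ t ! (s + r) ≡ t ! (p + (s + r))
    shifted-mismatch r<n same = mismatch r<n (begin
      t ! (c + s + r)       ≡⟨ sym (match left-copy (≤-trans r<n (m≤n+m n p))) ⟩
      t ! (s + r)           ≡⟨ same ⟩
      t ! (p + (s + r))     ≡⟨ cong (t !_) (sym (+-assoc p s r)) ⟩
      t ! (p + s + r)       ≡⟨ match right-copy r<n ⟩
      t ! (c + (p + s) + r) ∎)
      where open ≡-Reasoning

  bs+r≤X : length bs + r ≤ length X
  bs+r≤X = subst (_≤ length X) (trans (sym (+-assoc p s r)) (cong (_+ r) p+s≡bs))
    (longest-periodic-prefix-max X-longest bound (Agree-++ bs-periodic shifted-lce))
    where
    shifted-lce : Agree t s (p + s) r
    shifted-lce = Agree-trans (Agree-≤ (≤-trans r≤n (m≤n+m n p)) left-copy)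
      (Agree-trans lce-agree (Agree-sym (Agree-≤ r≤n right-copy)))
    bound : p + (s + r) ≤ length t
    bound = begin
      p + (s + r)     ≡⟨ sym (+-assoc p s r) ⟩
      p + s + r       ≤⟨ +-monoʳ-≤ (p + s) r≤n ⟩
      p + s + n       ≤⟨ +-monoˡ-≤ n (m≤n+m (p + s) c) ⟩
      c + (p + s) + n ≡⟨ cong (_+ n) (sym U≡c+bs) ⟩
      length U + n    ≡⟨ sym t≡U+n ⟩
      length t        ∎
      where open ≤-Reasoning

  per-X≡p : ∀ {q} → IsPer X q → q ≡ p
  per-X≡p = per-unique bs-prefix-X p-per (proj₁ (proj₂ X-longest))
    where
    bs-prefix-X : IsPrefix bs X
    bs-prefix-X = prefix-of-prefix bs-prefix-t (proj₁ X-longest)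
      (≤-trans (m≤m+n (length bs) r) bs+r≤X)

  X≤bs+r : r < n → length X ≤ length bs + r
  X≤bs+r r<n with longest-periodic-prefix-Agree X-longest
  ... | y , p+y≡X , X-periodic = begin
    length X      ≡⟨ sym p+y≡X ⟩
    p + y         ≤⟨ +-monoʳ-≤ p y≤s+r ⟩
    p + (s + r)   ≡⟨ sym (+-assoc p s r) ⟩
    p + s + r     ≡⟨ cong (_+ r) p+s≡bs ⟩
    length bs + r ∎
    where
    open ≤-Reasoning
    y≤s+r : y ≤ s + r
    y≤s+r with y ≤? s + r
    ... | yes y≤s+r = y≤s+r
    ... | no y≰s+r = contradiction (match X-periodic (≰⇒> y≰s+r)) (shifted-mismatch r<n)

  extended-border : r ≡ n → ∀ {b} → IsBorder U b → p ≤ length b → length b + r ≤ length X →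
    IsBorder t (b ++ R)
  extended-border r≡n {b} (b<U , b-prefix , front , front++b≡U) p≤b b+r≤X
    with longest-periodic-prefix-Agree X-longest
  ... | y , p+y≡X , X-periodic =
    bR<t , ++-prefix R (prefix-trans b-prefix U-prefix) R-follows ,
    front , suffix-++ {u = b} {front} front++b≡U U++R≡t
    where
    e u : ℕ
    e = length front
    u = length b ∸ p
    u+p≡b : u + p ≡ length b
    u+p≡b = m∸n+n≡m p≤b
    e+b≡U : e + length b ≡ length U
    e+b≡U = trans (sym (length-++ front)) (cong length front++b≡U)
    u+n≤y : u + n ≤ y
    u+n≤y = +-cancelˡ-≤ p _ _ (begin
      p + (u + n)    ≡⟨ sym (+-assoc p u n) ⟩
      p + u + n      ≡⟨ cong (_+ n) (trans (+-comm p u) u+p≡b) ⟩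
      length b + n   ≡⟨ cong (length b +_) (sym r≡n) ⟩
      length b + r   ≤⟨ b+r≤X ⟩
      length X       ≡⟨ sym p+y≡X ⟩
      p + y          ∎)
      where open ≤-Reasoning
    e+u≡c+s : e + u ≡ c + s
    e+u≡c+s = +-cancelʳ-≡ p (e + u) (c + s)
      (trans (+-assoc e u p) (trans (cong (e +_) u+p≡b) (trans e+b≡U (trans U≡c+bs c+[p+s]≡c+s+p))))
    X-window : Agree t u (u + p) n
    X-window = subst (λ a → Agree t u a n) (+-comm p u) (Agree-drop u (Agree-≤ u+n≤y X-periodic))
    lce-window : Agree t (c + s) (c + s + p) n
    lce-window = subst₂ (Agree t (c + s)) c+[p+s]≡c+s+p r≡n lce-agree
    same-start : Agree t u (c + s) p
    same-start = subst (λ a → Agree t u a p) e+u≡c+s (Agree-drop u (subst (Agree t 0 e) (sym u+p≡b)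
      (Agree-prefix⁺ U-prefix (<⇒≤ b<U) (≤-reflexive e+b≡U)
        (border-Agree {v = front} b-prefix front++b≡U))))
    b-continues-as-U : Agree t (length b) (length U) n
    b-continues-as-U = subst₂ (λ a a′ → Agree t a a′ n) u+p≡b
      (trans (sym c+[p+s]≡c+s+p) (sym U≡c+bs))
      (Agree-drop p (Agree-periodic n (period-pos (proj₁ p-per)) X-window lce-window same-start))
    R-follows : ∀ {j} → j < length R → t ! (length b + j) ≡ R ! j
    R-follows {j} j<n = trans (match b-continues-as-U j<n) (suffix-! {u = R} {U} U++R≡t j)
    bR<t : length (b ++ R) < length t
    bR<t = subst₂ _<_ (sym (length-++ b)) (sym t≡U+n) (+-monoˡ-< n b<U)

  border-bound : ∀ b → IsBorder U b → length b + r ≤ length X → length b ≤ length bs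
  border-bound b b-border b+r≤X with r <? n | p ≤? length b
  ... | yes r<n | _       = +-cancelʳ-≤ r _ _ (≤-trans b+r≤X (X≤bs+r r<n))
  ... | no r≮n  | no p≰b  = <⇒≤ (<-≤-trans (≰⇒> p≰b) (period-≤ (proj₁ p-per)))
  ... | no r≮n  | yes p≤b = +-cancelʳ-≤ n _ _ (subst₂ _≤_ (length-++ b) (length-++ bs)
    (proj₂ bsR-longest (b ++ R) (extended-border (≤-antisym r≤n (≮⇒≥ r≮n)) b-border p≤b b+r≤X)))

  scaled-bounds : ∀ {q} → IsPer X q →
    ((length bs + r) * q ≤ length X * p) ×
    (∀ b → IsBorder U b → (length b + r) * q ≤ length X * p → length b ≤ length bs)
  scaled-bounds q-per rewrite per-X≡p q-per =
    *-monoˡ-≤ p bs+r≤X ,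
    λ b b-border scaled → border-bound b b-border (*-cancelʳ-≤ _ _ p {{p-nonZero}} scaled)

corollary11 : {A : Set} (T w : List A) (i j : ℕ) →
    1 ≤ j → j ≤ length T → 1 ≤ i → i ≤ j + 1 →
    let L = take (i ∸ 1) T
        R = drop j T
        T′ = L ++ w ++ R
        Lw = L ++ w
    in length R ≤ length L →
       2 * length w ≤ length L →
       (∃ λ b → IsLongestBorder Lw b × length w < length b) →
       (∃ λ b → IsBorder T′ b × length R < length b) →
       (bs : List A) → IsBorder Lw bs → IsLongestBorder T′ (bs ++ R) →
       (p : ℕ) → IsPer bs p →
       2 * p ≤ length bs →
       (X : List A) → IsLongestPrefixWithPeriod T′ p X →
       (q : ℕ) → IsPer X q →
       (r : ℕ) → IsLCE T′ (length Lw ∸ p) (length Lw) r →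
       -- α = |X| / q ; condition |b| ≤ α p − r written as (|b| + r) q ≤ |X| p
       ((length bs + r) * q ≤ length X * p) ×
       (∀ b → IsBorder Lw b → (length b + r) * q ≤ length X * p →
          length b ≤ length bs)
corollary11 T w i j _ _ _ _ _ _ _ _
  bs (_ , bs-prefix , v , v++bs≡Lw) bsR-longest p p-per _ X X-longest q q-per r r-lce =
  scaled-bounds q-per
  where
  open BordersAfterEdit (++-assoc (take (i ∸ 1) T) w (drop j T))
    bs-prefix v++bs≡Lw bsR-longest p-per X-longest r-lce
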